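{- Let $k,m,n$ be positive integers with $m\leq n$. Every $m\times n$ $k$-latin rectangle $P$ embeds in a $k$-latin square of order $n$; that is, there is a $k$-latin square $L$ of order $n$ with $P(i,j)\subseteq L(i,j)$ for all $i,j\in N(n)$ (so $L(i,j)=P(i,j)$ for $i\leq m$).
   Context: For a positive integer $a$, $N(a)=\{1,\dots,a\}$; multiset containment counts multiplicities. A partial $k$-latin square of order $n$ is an $n\times n$ array $P$ whose cell $(i,j)$ contains a multiset $P(i,j)$ of cardinality at most $k$ with elements from $N(n)$, such that each symbol occurs at most $k$ times in each row and at most $k$ times in each column. A $k$-latin square of order $n$ is one in which every cell has exactly $k$ symbols. An $m\times n$ $k$-latin rectangle is a partial $k$-latin square of order $n$ in which each cell of rows $1,\dots,m$ contains exactly $k$ symbols and all cells of rows $m+1,\dots,n$ are empty. -}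

module Defs where

open import Data.Nat using (ℕ; zero; suc; _+_; _≤_; _<_; _≥_)
open import Data.Fin using (Fin; toℕ)
open import Data.Product using (_×_)
open import Relation.Binary.PropositionalEquality using (_≡_)

sumFin : ∀ {n} → (Fin n → ℕ) → ℕ
sumFin {zero}  f = 0
sumFin {suc n} f = f Fin.zero + sumFin (λ i → f (Fin.suc i))

-- A multiset with elements from N(n) = {1..n}, encoded over Fin n
-- (symbol s ↔ toℕ s + 1) by its multiplicity function.
Multiset : ℕ → Set
Multiset n = Fin n → ℕ

card : ∀ {n} → Multiset n → ℕ
card = sumFin

_⊆ₘ_ : ∀ {n} → Multiset n → Multiset n → Set
A ⊆ₘ B = ∀ s → A s ≤ B s

-- An n×n array of multisets with elements from N(n); rows and columns
-- are indexed by Fin n (row i ↔ toℕ i + 1).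
Array : ℕ → Set
Array n = Fin n → Fin n → Multiset n

rowCount : ∀ {n} → Array n → Fin n → Fin n → ℕ
rowCount P i s = sumFin (λ j → P i j s)

colCount : ∀ {n} → Array n → Fin n → Fin n → ℕ
colCount P j s = sumFin (λ i → P i j s)

PartialKLatinSquare : ℕ → (n : ℕ) → Array n → Set
PartialKLatinSquare k n P =
  (∀ i j → card (P i j) ≤ k) ×
  (∀ i s → rowCount P i s ≤ k) ×
  (∀ j s → colCount P j s ≤ k)

KLatinSquare : ℕ → (n : ℕ) → Array n → Set
KLatinSquare k n P =
  PartialKLatinSquare k n P × (∀ i j → card (P i j) ≡ k)

-- m×n k-latin rectangle: rows 1..m (toℕ i < m) full, rows m+1..n empty
KLatinRectangle : ℕ → ℕ → (n : ℕ) → Array n → Set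
KLatinRectangle k m n P =
  PartialKLatinSquare k n P ×
  (∀ i j → toℕ i < m → card (P i j) ≡ k) ×
  (∀ i j → m ≤ toℕ i → ∀ s → P i j s ≡ 0)

module Submission where

-- The rectangle is completed one row at a time. When rows 0,…,m-1 are full
-- and m < n, let capacity j s = k ∸ (occurrences of s in column j). Every
-- row and every column of this n×n matrix sums to (n ∸ m)·k ≥ k, and any
-- matrix R ≤ capacity whose rows and columns all sum to k is a valid new row
-- (cell j receives symbol s exactly R j s times). Such an R is obtained by
-- peeling k permutation matrices off the capacity matrix; each exists because
-- a matrix with equal positive line sums has a positive diagonal, which is
-- Hall's marriage theorem applied to the supports of its rows.

open import Defs
open import Data.Bool.Base using (if_then_else_)
open import Data.Fin.Base using (Fin; zero; suc; toℕ; fromℕ<)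
open import Data.Fin.Properties using (toℕ-fromℕ<; toℕ-injective; toℕ<n; suc-injective; _≟_)
open import Data.Fin.Subset using (Subset; inside; outside; ⊥; ⊤; ⁅_⁆; _∈_; _∉_; _⊆_; _⊂_; _∩_; _∪_; _─_; _-_; ∣_∣; Nonempty; Empty)
open import Data.Fin.Subset.Properties using (_∈?_; nonempty?; Empty-unique; ∣⊥∣≡0; ∉⊥; x∈p∪q⁺; x∈p∪q⁻; x∈p∩q⁺; x∈p∩q⁻; x∈p∧x∉q⇒x∈p─q; p⊆q⇒∣p∣≤∣q∣; x∈⁅y⁆⇒x≡y; x∈⁅x⁆; ∣⁅x⁆∣≡1; p─q⊆p; ∣p∩q∣≤∣p∣; _⊂?_; p⊂q⇒∣p∣<∣q∣; p∩q≢∅⇒∣p─q∣<∣p∣; x∈p⇒∣p-x∣<∣p∣; anySubset?; ∈⊤; ∩-identityʳ)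
open import Data.Nat.Base using (ℕ; zero; suc; _+_; _*_; _∸_; _≤_; _<_; z≤n; s≤s; s≤s⁻¹; NonZero)
open import Data.Nat.Properties hiding (_≟_; suc-injective)
open import Data.Sum.Base using (inj₁; inj₂)
open import Data.Vec.Base using ([]; _∷_; here; there; tabulate)
open import Data.Vec.Properties using (lookup∘tabulate; lookup⇒[]=; []=⇒lookup)
open import Data.Product.Base using (Σ; ∃; _×_; _,_; proj₁; proj₂)
open import Function.Base using (_∘_)
open import Function.Definitions using (Injective)
open import Relation.Binary.PropositionalEquality using (_≡_; _≢_; refl; sym; trans; cong; cong₂; subst; module ≡-Reasoning)
open import Relation.Nullary.Decidable.Core using (Dec; yes; no; does; _×-dec_)
open import Relation.Nullary.Decidable using (dec-true; dec-false; decidable-stable)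
open import Relation.Nullary.Negation.Core using (¬_; contradiction)
open import Relation.Unary using (Decidable)

open import Algebra.Properties.Semiring.Sum +-*-semiring using (sum; ∑-distrib-+; ∑-comm; *-distribˡ-sum)

sumFin≡sum : ∀ {n} (f : Fin n → ℕ) → sumFin f ≡ sum f
sumFin≡sum {zero}  f = refl
sumFin≡sum {suc n} f = cong (f zero +_) (sumFin≡sum (f ∘ suc))

sum-cong : ∀ {n} {f g : Fin n → ℕ} → (∀ i → f i ≡ g i) → sumFin f ≡ sumFin g
sum-cong {zero}  f≗g = refl
sum-cong {suc n} f≗g = cong₂ _+_ (f≗g zero) (sum-cong (f≗g ∘ suc))

sum-mono : ∀ {n} {f g : Fin n → ℕ} → (∀ i → f i ≤ g i) → sumFin f ≤ sumFin g
sum-mono {zero}  f≤g = z≤n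
sum-mono {suc n} f≤g = +-mono-≤ (f≤g zero) (sum-mono (f≤g ∘ suc))

sum-+ : ∀ {n} (f g : Fin n → ℕ) → sumFin (λ i → f i + g i) ≡ sumFin f + sumFin g
sum-+ f g = trans (sumFin≡sum (λ i → f i + g i)) (trans (∑-distrib-+ f g) (sym (cong₂ _+_ (sumFin≡sum f) (sumFin≡sum g))))

sum-* : ∀ {n} c (f : Fin n → ℕ) → sumFin (λ i → c * f i) ≡ c * sumFin f
sum-* c f = trans (sumFin≡sum (λ i → c * f i)) (trans (sym (*-distribˡ-sum c f)) (cong (c *_) (sym (sumFin≡sum f))))

sum-swap : ∀ {a b} (f : Fin a → Fin b → ℕ) →
           sumFin (λ i → sumFin (f i)) ≡ sumFin (λ j → sumFin (λ i → f i j))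
sum-swap f = begin
  sumFin (λ i → sumFin (f i))            ≡⟨ sum-cong (λ i → sumFin≡sum (f i)) ⟩
  sumFin (λ i → sum (f i))               ≡⟨ sumFin≡sum (λ i → sum (f i)) ⟩
  sum (λ i → sum (f i))                  ≡⟨ ∑-comm f ⟩
  sum (λ j → sum (λ i → f i j))          ≡⟨ sumFin≡sum (λ j → sum (λ i → f i j)) ⟨
  sumFin (λ j → sum (λ i → f i j))       ≡⟨ sum-cong (λ j → sumFin≡sum (λ i → f i j)) ⟨
  sumFin (λ j → sumFin (λ i → f i j))    ∎
  where open ≡-Reasoning

sum-const : ∀ n c → sumFin {n} (λ _ → c) ≡ n * c
sum-const zero    c = refl
sum-const (suc n) c = cong (c +_) (sum-const n c)

sum-zero : ∀ n → sumFin {n} (λ _ → 0) ≡ 0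
sum-zero n = trans (sum-const n 0) (*-zeroʳ n)

sum≡0⇒≡0 : ∀ {n} (f : Fin n → ℕ) → sumFin f ≡ 0 → ∀ i → f i ≡ 0
sum≡0⇒≡0 f Σf≡0 zero    = m+n≡0⇒m≡0 (f zero) Σf≡0
sum≡0⇒≡0 f Σf≡0 (suc i) = sum≡0⇒≡0 (f ∘ suc) (m+n≡0⇒n≡0 (f zero) Σf≡0) i

sum-∸ : ∀ {n} (f g : Fin n → ℕ) → (∀ i → g i ≤ f i) →
        sumFin (λ i → f i ∸ g i) ≡ sumFin f ∸ sumFin g
sum-∸ f g g≤f = begin
  sumFin (λ i → f i ∸ g i)                              ≡⟨ m+n∸n≡m _ (sumFin g) ⟨
  sumFin (λ i → f i ∸ g i) + sumFin g ∸ sumFin g        ≡⟨ cong (_∸ sumFin g) (sum-+ (λ i → f i ∸ g i) g) ⟨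
  sumFin (λ i → f i ∸ g i + g i) ∸ sumFin g             ≡⟨ cong (_∸ sumFin g) (sum-cong (λ i → m∸n+n≡m (g≤f i))) ⟩
  sumFin f ∸ sumFin g                                   ∎
  where open ≡-Reasoning

sum-tight : ∀ {n} k (f : Fin n → ℕ) → (∀ i → f i ≤ k) → sumFin f ≡ n * k → ∀ i → f i ≡ k
sum-tight {n} k f f≤k Σf≡nk i =
  ≤-antisym (f≤k i) (m∸n≡0⇒m≤n (sum≡0⇒≡0 (λ i → k ∸ f i) slack≡0 i))
  where
  slack≡0 : sumFin (λ i → k ∸ f i) ≡ 0
  slack≡0 = trans (sum-∸ (λ _ → k) f f≤k)
                  (trans (cong₂ _∸_ (sum-const n k) Σf≡nk) (n∸n≡0 (n * k)))

⟦_⟧ : {P : Set} → Dec P → ℕ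
⟦ P? ⟧ = if does P? then 1 else 0

sum-δ : ∀ {n} (a : Fin n) (c : Fin n → ℕ) → sumFin (λ i → ⟦ a ≟ i ⟧ * c i) ≡ c a
sum-δ {suc n} zero    c = trans (cong₂ _+_ (+-identityʳ (c zero)) (sum-zero n)) (+-identityʳ (c zero))
sum-δ {suc n} (suc a) c = sum-δ a (c ∘ suc)

preimage≤1 : ∀ {a n} (μ : Fin a → Fin n) → Injective _≡_ _≡_ μ →
             ∀ s → sumFin (λ i → ⟦ μ i ≟ s ⟧) ≤ 1
preimage≤1 {zero}  μ μ-inj s = z≤n
preimage≤1 {suc a} μ μ-inj s with μ zero ≟ s
... | yes μ₀≡s = s≤s (≤-reflexive (trans (sum-cong missed) (sum-zero a)))
  where
  missed : ∀ i → ⟦ μ (suc i) ≟ s ⟧ ≡ 0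
  missed i with μ (suc i) ≟ s
  ... | yes μᵢ≡s = contradiction (μ-inj (trans μ₀≡s (sym μᵢ≡s))) λ ()
  ... | no _     = refl
... | no _ = preimage≤1 (μ ∘ suc) (suc-injective ∘ μ-inj) s

∣p∪q∣≤∣p∣+∣q∣ : ∀ {n} (p q : Subset n) → ∣ p ∪ q ∣ ≤ ∣ p ∣ + ∣ q ∣
∣p∪q∣≤∣p∣+∣q∣ []            []            = z≤n
∣p∪q∣≤∣p∣+∣q∣ (outside ∷ p) (outside ∷ q) = ∣p∪q∣≤∣p∣+∣q∣ p q
∣p∪q∣≤∣p∣+∣q∣ (inside  ∷ p) (outside ∷ q) = s≤s (∣p∪q∣≤∣p∣+∣q∣ p q)
∣p∪q∣≤∣p∣+∣q∣ (outside ∷ p) (inside  ∷ q) =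
  ≤-trans (s≤s (∣p∪q∣≤∣p∣+∣q∣ p q)) (≤-reflexive (sym (+-suc ∣ p ∣ ∣ q ∣)))
∣p∪q∣≤∣p∣+∣q∣ (inside  ∷ p) (inside  ∷ q) =
  s≤s (≤-trans (∣p∪q∣≤∣p∣+∣q∣ p q) (+-monoʳ-≤ ∣ p ∣ (n≤1+n ∣ q ∣)))

∣p∪q∣≡∣p∣+∣q∣ : ∀ {n} (p q : Subset n) → (∀ {x} → x ∈ p → x ∉ q) → ∣ p ∪ q ∣ ≡ ∣ p ∣ + ∣ q ∣
∣p∪q∣≡∣p∣+∣q∣ []            []            disjoint = refl
∣p∪q∣≡∣p∣+∣q∣ (outside ∷ p) (outside ∷ q) disjoint =
  ∣p∪q∣≡∣p∣+∣q∣ p q (λ x∈p x∈q → disjoint (there x∈p) (there x∈q))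
∣p∪q∣≡∣p∣+∣q∣ (inside  ∷ p) (outside ∷ q) disjoint =
  cong suc (∣p∪q∣≡∣p∣+∣q∣ p q (λ x∈p x∈q → disjoint (there x∈p) (there x∈q)))
∣p∪q∣≡∣p∣+∣q∣ (outside ∷ p) (inside  ∷ q) disjoint =
  trans (cong suc (∣p∪q∣≡∣p∣+∣q∣ p q (λ x∈p x∈q → disjoint (there x∈p) (there x∈q))))
        (sym (+-suc ∣ p ∣ ∣ q ∣))
∣p∪q∣≡∣p∣+∣q∣ (inside  ∷ p) (inside  ∷ q) disjoint = contradiction here (disjoint here)

x∈p─q⇒x∉q : ∀ {n} {p q : Subset n} {x} → x ∈ p ─ q → x ∉ q
x∈p─q⇒x∉q {p = _ ∷ _} {q = outside ∷ _} here        ()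
x∈p─q⇒x∉q {p = _ ∷ _} {q = _ ∷ _}       (there x∈) (there x∈q) = x∈p─q⇒x∉q x∈ x∈q

∣Empty∣≡0 : ∀ {n} {p : Subset n} → Empty p → ∣ p ∣ ≡ 0
∣Empty∣≡0 {n} empty = trans (cong ∣_∣ (Empty-unique empty)) (∣⊥∣≡0 n)

∣p∣>0⇒Nonempty : ∀ {n} (p : Subset n) → 0 < ∣ p ∣ → Nonempty p
∣p∣>0⇒Nonempty p 0<∣p∣ with nonempty? p
... | yes nonempty = nonempty
... | no  empty    = contradiction (∣Empty∣≡0 empty) (>⇒≢ 0<∣p∣)

∣p∩q∣≤∣p∩[q─r]∣+∣r∩q∣ : ∀ {n} (p q r : Subset n) → ∣ p ∩ q ∣ ≤ ∣ p ∩ (q ─ r) ∣ + ∣ r ∩ q ∣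
∣p∩q∣≤∣p∩[q─r]∣+∣r∩q∣ p q r =
  ≤-trans (p⊆q⇒∣p∣≤∣q∣ split) (∣p∪q∣≤∣p∣+∣q∣ (p ∩ (q ─ r)) (r ∩ q))
  where
  split : p ∩ q ⊆ (p ∩ (q ─ r)) ∪ (r ∩ q)
  split {x} x∈p∩q with x∈p∩q⁻ p q x∈p∩q | x ∈? r
  ... | x∈p , x∈q | yes x∈r = x∈p∪q⁺ (inj₂ (x∈p∩q⁺ (x∈r , x∈q)))
  ... | x∈p , x∈q | no  x∉r = x∈p∪q⁺ (inj₁ (x∈p∩q⁺ (x∈p , x∈p∧x∉q⇒x∈p─q x∈q x∉r)))

-- The neighbourhood ⋃_{x ∈ p} E x of a set p of left vertices, in the
-- bipartite graph where the left vertex x is adjacent to the right vertices E x.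
neighbours : ∀ {a b} → (Fin a → Subset b) → Subset a → Subset b
neighbours E []            = ⊥
neighbours E (outside ∷ p) = neighbours (E ∘ suc) p
neighbours E (inside  ∷ p) = E zero ∪ neighbours (E ∘ suc) p

neighbours⁺ : ∀ {a b} (E : Fin a → Subset b) {p x y} → x ∈ p → y ∈ E x → y ∈ neighbours E p
neighbours⁺ E {inside  ∷ p} here        y∈Ex = x∈p∪q⁺ (inj₁ y∈Ex)
neighbours⁺ E {outside ∷ p} (there x∈p) y∈Ex = neighbours⁺ (E ∘ suc) x∈p y∈Ex
neighbours⁺ E {inside  ∷ p} (there x∈p) y∈Ex = x∈p∪q⁺ (inj₂ (neighbours⁺ (E ∘ suc) x∈p y∈Ex))

neighbours⁻ : ∀ {a b} (E : Fin a → Subset b) p {y} → y ∈ neighbours E p → ∃ λ x → x ∈ p × y ∈ E x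
neighbours⁻ E []            y∈N = contradiction y∈N ∉⊥
neighbours⁻ E (outside ∷ p) y∈N with neighbours⁻ (E ∘ suc) p y∈N
... | x , x∈p , y∈Ex = suc x , there x∈p , y∈Ex
neighbours⁻ E (inside  ∷ p) y∈N with x∈p∪q⁻ (E zero) (neighbours (E ∘ suc) p) y∈N
... | inj₁ y∈E₀ = zero , here , y∈E₀
... | inj₂ y∈N′ with neighbours⁻ (E ∘ suc) p y∈N′
...   | x , x∈p , y∈Ex = suc x , there x∈p , y∈Ex

neighbours-∪ : ∀ {a b} (E : Fin a → Subset b) p q → neighbours E (p ∪ q) ⊆ neighbours E p ∪ neighbours E q
neighbours-∪ E p q y∈N with neighbours⁻ E (p ∪ q) y∈N
... | x , x∈p∪q , y∈Ex with x∈p∪q⁻ p q x∈p∪q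
...   | inj₁ x∈p = x∈p∪q⁺ (inj₁ (neighbours⁺ E x∈p y∈Ex))
...   | inj₂ x∈q = x∈p∪q⁺ (inj₂ (neighbours⁺ E x∈q y∈Ex))

-- Hall's marriage theorem for the bipartite graph E, relative to a set A of
-- left vertices to be matched and a set B of right vertices that may be used.
module Hall {a b : ℕ} (E : Fin a → Subset b) where

  N : Subset a → Subset b
  N = neighbours E

  HallCondition : Subset a → Subset b → Set
  HallCondition A B = ∀ S → S ⊆ A → ∣ S ∣ ≤ ∣ N S ∩ B ∣

  record Matching (A : Subset a) (B : Subset b) : Set where
    field
      partner   : ∀ {x} → x ∈ A → Fin b
      adjacent  : ∀ {x} (x∈A : x ∈ A) → partner x∈A ∈ E x
      available : ∀ {x} (x∈A : x ∈ A) → partner x∈A ∈ B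
      injective : ∀ {x y} (x∈A : x ∈ A) (y∈A : y ∈ A) → partner x∈A ≡ partner y∈A → x ≡ y
  open Matching

  widen : ∀ {A B B′} → B′ ⊆ B → Matching A B′ → Matching A B
  widen B′⊆B M = record
    { partner   = partner M
    ; adjacent  = adjacent M
    ; available = B′⊆B ∘ available M
    ; injective = injective M
    }

  emptyMatching : ∀ {A B} → Empty A → Matching A B
  emptyMatching empty = record
    { partner   = λ x∈A → contradiction (_ , x∈A) empty
    ; adjacent  = λ x∈A → contradiction (_ , x∈A) empty
    ; available = λ x∈A → contradiction (_ , x∈A) empty
    ; injective = λ x∈A _ _ → contradiction (_ , x∈A) empty
    }

  singleMatching : ∀ {x₀ y B} → y ∈ E x₀ → y ∈ B → Matching ⁅ x₀ ⁆ B
  singleMatching {x₀} {y} y∈Ex₀ y∈B = record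
    { partner   = λ _ → y
    ; adjacent  = λ x∈⁅x₀⁆ → subst (λ x → y ∈ E x) (sym (x∈⁅y⁆⇒x≡y x₀ x∈⁅x₀⁆)) y∈Ex₀
    ; available = λ _ → y∈B
    ; injective = λ x∈⁅x₀⁆ x′∈⁅x₀⁆ _ → trans (x∈⁅y⁆⇒x≡y x₀ x∈⁅x₀⁆) (sym (x∈⁅y⁆⇒x≡y x₀ x′∈⁅x₀⁆))
    }

  glue : ∀ {A B} S (M : Matching S B) (M′ : Matching (A ─ S) B) →
         (∀ {x y} (x∈S : x ∈ S) (y∈A─S : y ∈ A ─ S) → partner M x∈S ≢ partner M′ y∈A─S) →
         Matching A B
  glue {A} {B} S M M′ apart = record
    { partner = choose ; adjacent = adjacent′ ; available = available′ ; injective = injective′ }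
    where
    choose : ∀ {x} → x ∈ A → Fin b
    choose {x} x∈A with x ∈? S
    ... | yes x∈S = partner M x∈S
    ... | no  x∉S = partner M′ (x∈p∧x∉q⇒x∈p─q x∈A x∉S)

    adjacent′ : ∀ {x} (x∈A : x ∈ A) → choose x∈A ∈ E x
    adjacent′ {x} x∈A with x ∈? S
    ... | yes x∈S = adjacent M x∈S
    ... | no  x∉S = adjacent M′ (x∈p∧x∉q⇒x∈p─q x∈A x∉S)

    available′ : ∀ {x} (x∈A : x ∈ A) → choose x∈A ∈ B
    available′ {x} x∈A with x ∈? S
    ... | yes x∈S = available M x∈S
    ... | no  x∉S = available M′ (x∈p∧x∉q⇒x∈p─q x∈A x∉S)

    injective′ : ∀ {x y} (x∈A : x ∈ A) (y∈A : y ∈ A) → choose x∈A ≡ choose y∈A → x ≡ y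
    injective′ {x} {y} x∈A y∈A same with x ∈? S | y ∈? S
    ... | yes x∈S | yes y∈S = injective M x∈S y∈S same
    ... | no  _   | no  _   = injective M′ _ _ same
    ... | yes x∈S | no  _   = contradiction same (apart x∈S _)
    ... | no  _   | yes y∈S = contradiction (sym same) (apart y∈S _)

  Critical : Subset a → Subset b → Subset a → Set
  Critical A B S = Nonempty S × S ⊂ A × ∣ N S ∩ B ∣ ≤ ∣ S ∣

  -- Criticality is decidable, so by finiteness we can search for a critical set.
  critical? : ∀ A B → Decidable (Critical A B)
  critical? A B S = nonempty? S ×-dec (S ⊂? A ×-dec ∣ N S ∩ B ∣ ≤? ∣ S ∣)

  hallWithoutCritical : ∀ {A B S} → HallCondition A B → S ⊆ A → ∣ N S ∩ B ∣ ≤ ∣ S ∣ →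
                        HallCondition (A ─ S) (B ─ N S)
  hallWithoutCritical {A} {B} {S} hallAB S⊆A tight U U⊆A─S =
    +-cancelʳ-≤ (∣ S ∣) (∣ U ∣) (∣ N U ∩ (B ─ N S) ∣) (begin
      ∣ U ∣ + ∣ S ∣                               ≡⟨ ∣p∪q∣≡∣p∣+∣q∣ U S U∩S≡∅ ⟨
      ∣ U ∪ S ∣                                   ≤⟨ hallAB (U ∪ S) U∪S⊆A ⟩
      ∣ N (U ∪ S) ∩ B ∣                           ≤⟨ ∣p∩q∣≤∣p∩[q─r]∣+∣r∩q∣ (N (U ∪ S)) B (N S) ⟩
      ∣ N (U ∪ S) ∩ (B ─ N S) ∣ + ∣ N S ∩ B ∣     ≤⟨ +-mono-≤ (p⊆q⇒∣p∣≤∣q∣ fresh) tight ⟩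
      ∣ N U ∩ (B ─ N S) ∣ + ∣ S ∣                 ∎)
    where
    open ≤-Reasoning
    U∩S≡∅ : ∀ {x} → x ∈ U → x ∉ S
    U∩S≡∅ x∈U = x∈p─q⇒x∉q (U⊆A─S x∈U)
    U∪S⊆A : U ∪ S ⊆ A
    U∪S⊆A x∈U∪S with x∈p∪q⁻ U S x∈U∪S
    ... | inj₁ x∈U = p─q⊆p A S (U⊆A─S x∈U)
    ... | inj₂ x∈S = S⊆A x∈S
    fresh : N (U ∪ S) ∩ (B ─ N S) ⊆ N U ∩ (B ─ N S)
    fresh y∈ with x∈p∩q⁻ (N (U ∪ S)) (B ─ N S) y∈
    ... | y∈N , y∈B─NS with x∈p∪q⁻ (N U) (N S) (neighbours-∪ E U S y∈N)
    ...   | inj₁ y∈NU = x∈p∩q⁺ (y∈NU , y∈B─NS)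
    ...   | inj₂ y∈NS = contradiction y∈NS (x∈p─q⇒x∉q y∈B─NS)

  -- If A has no critical set, removing any x₀ ∈ A and any y preserves Hall's
  -- condition: every nonempty U ⊆ A - x₀ has a surplus neighbour to spare.
  hallWithoutVertex : ∀ {A B x₀ y} → (∀ S → ¬ Critical A B S) → x₀ ∈ A →
                      HallCondition (A - x₀) (B - y)
  hallWithoutVertex {A} {B} {x₀} {y} noCritical x₀∈A U U⊆A-x₀ with nonempty? U
  ... | no  empty    = ≤-trans (≤-reflexive (∣Empty∣≡0 empty)) z≤n
  ... | yes nonempty = s≤s⁻¹ (begin
      suc ∣ U ∣                               ≤⟨ ≰⇒> (λ tight → noCritical U (nonempty , U⊂A , tight)) ⟩
      ∣ N U ∩ B ∣                             ≤⟨ ∣p∩q∣≤∣p∩[q─r]∣+∣r∩q∣ (N U) B ⁅ y ⁆ ⟩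
      ∣ N U ∩ (B - y) ∣ + ∣ ⁅ y ⁆ ∩ B ∣       ≤⟨ +-monoʳ-≤ (∣ N U ∩ (B - y) ∣) (∣p∩q∣≤∣p∣ ⁅ y ⁆ B) ⟩
      ∣ N U ∩ (B - y) ∣ + ∣ ⁅ y ⁆ ∣           ≡⟨ cong (∣ N U ∩ (B - y) ∣ +_) (∣⁅x⁆∣≡1 y) ⟩
      ∣ N U ∩ (B - y) ∣ + 1                   ≡⟨ +-comm (∣ N U ∩ (B - y) ∣) 1 ⟩
      suc ∣ N U ∩ (B - y) ∣                   ∎)
    where
    open ≤-Reasoning
    U⊂A : U ⊂ A
    U⊂A = (λ x∈U → p─q⊆p A ⁅ x₀ ⁆ (U⊆A-x₀ x∈U))
        , x₀ , x₀∈A , λ x₀∈U → x∈p─q⇒x∉q (U⊆A-x₀ x₀∈U) (x∈⁅x⁆ x₀)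

  Smaller : Subset a → Set
  Smaller A = ∀ A′ B′ → ∣ A′ ∣ < ∣ A ∣ → HallCondition A′ B′ → Matching A′ B′

  -- With a critical set S: match S into B and, independently, A ─ S into B ─ N(S).
  matchAtCritical : ∀ {A B S} → HallCondition A B → Critical A B S → Smaller A → Matching A B
  matchAtCritical {A} {B} {S} hallAB ((x , x∈S) , S⊂A , tight) smaller =
    glue S M (widen (p─q⊆p B (N S)) M′) apart
    where
    S⊆A : S ⊆ A
    S⊆A = proj₁ S⊂A
    M : Matching S B
    M = smaller S B (p⊂q⇒∣p∣<∣q∣ S⊂A) (λ U U⊆S → hallAB U (λ x∈U → S⊆A (U⊆S x∈U)))
    M′ : Matching (A ─ S) (B ─ N S)
    M′ = smaller (A ─ S) (B ─ N S) (p∩q≢∅⇒∣p─q∣<∣p∣ A S (x , x∈p∩q⁺ (S⊆A x∈S , x∈S)))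
                 (hallWithoutCritical hallAB S⊆A tight)
    apart : ∀ {x y} (x∈S : x ∈ S) (y∈A─S : y ∈ A ─ S) → partner M x∈S ≢ partner M′ y∈A─S
    apart x∈S y∈A─S same = x∈p─q⇒x∉q (available M′ y∈A─S)
                                      (subst (_∈ N S) same (neighbours⁺ E x∈S (adjacent M x∈S)))

  availableNeighbour : ∀ {A B x₀} → HallCondition A B → x₀ ∈ A → ∃ λ y → y ∈ E x₀ × y ∈ B
  availableNeighbour {A} {B} {x₀} hallAB x₀∈A
    with ∣p∣>0⇒Nonempty (N ⁅ x₀ ⁆ ∩ B)
           (subst (_≤ ∣ N ⁅ x₀ ⁆ ∩ B ∣) (∣⁅x⁆∣≡1 x₀)
                  (hallAB ⁅ x₀ ⁆ (λ x∈⁅x₀⁆ → subst (_∈ A) (sym (x∈⁅y⁆⇒x≡y x₀ x∈⁅x₀⁆)) x₀∈A)))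
  ... | y , y∈N∩B with x∈p∩q⁻ (N ⁅ x₀ ⁆) B y∈N∩B
  ...   | y∈N , y∈B with neighbours⁻ E ⁅ x₀ ⁆ y∈N
  ...     | x , x∈⁅x₀⁆ , y∈Ex = y , subst (λ x → y ∈ E x) (x∈⁅y⁆⇒x≡y x₀ x∈⁅x₀⁆) y∈Ex , y∈B

  -- Without critical sets: match some x₀ ∈ A to an available neighbour y, and A - x₀ into B - y.
  matchAtVertex : ∀ {A B x₀} → HallCondition A B → (∀ S → ¬ Critical A B S) → x₀ ∈ A →
                  Smaller A → Matching A B
  matchAtVertex {A} {B} {x₀} hallAB noCritical x₀∈A smaller with availableNeighbour hallAB x₀∈A
  ... | y , y∈Ex₀ , y∈B = glue ⁅ x₀ ⁆ (singleMatching y∈Ex₀ y∈B) (widen (p─q⊆p B ⁅ y ⁆) M′) apart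
    where
    M′ : Matching (A - x₀) (B - y)
    M′ = smaller (A - x₀) (B - y) (x∈p⇒∣p-x∣<∣p∣ x₀∈A) (hallWithoutVertex noCritical x₀∈A)
    apart : ∀ {x z} (x∈⁅x₀⁆ : x ∈ ⁅ x₀ ⁆) (z∈A-x₀ : z ∈ A - x₀) → y ≢ partner M′ z∈A-x₀
    apart _ z∈A-x₀ same = x∈p─q⇒x∉q (available M′ z∈A-x₀) (subst (_∈ ⁅ y ⁆) same (x∈⁅x⁆ y))

  -- The Halmos–Vaughan induction step: either some proper subset is critical, or none is.
  hallStep : ∀ A B → HallCondition A B → Smaller A → Matching A B
  hallStep A B hallAB smaller with nonempty? A | anySubset? (critical? A B)
  ... | no  empty        | _              = emptyMatching empty
  ... | yes (x₀ , x₀∈A)  | yes (S , crit) = matchAtCritical hallAB crit smaller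
  ... | yes (x₀ , x₀∈A)  | no  noCritical = matchAtVertex hallAB (λ S crit → noCritical (S , crit)) x₀∈A smaller

  hall : ∀ A B → HallCondition A B → Matching A B
  hall A B = hallBelow (suc ∣ A ∣) A B ≤-refl
    where
    hallBelow : ∀ n A B → ∣ A ∣ < n → HallCondition A B → Matching A B
    hallBelow (suc n) A B ∣A∣<1+n hallAB =
      hallStep A B hallAB (λ A′ B′ ∣A′∣<∣A∣ → hallBelow n A′ B′ (≤-trans ∣A′∣<∣A∣ (s≤s⁻¹ ∣A∣<1+n)))

Matrix : ℕ → Set
Matrix n = Fin n → Fin n → ℕ

LineSums : ∀ {n} → Matrix n → ℕ → Set
LineSums D t = (∀ i → sumFin (D i) ≡ t) × (∀ j → sumFin (λ i → D i j) ≡ t)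

lineSums-+ : ∀ {n a b} {A B : Matrix n} → LineSums A a → LineSums B b →
             LineSums (λ i j → A i j + B i j) (a + b)
lineSums-+ {A = A} {B} (rowsA , colsA) (rowsB , colsB) =
    (λ i → trans (sum-+ (A i) (B i)) (cong₂ _+_ (rowsA i) (rowsB i)))
  , (λ j → trans (sum-+ (λ i → A i j) (λ i → B i j)) (cong₂ _+_ (colsA j) (colsB j)))

lineSums-∸ : ∀ {n a b} {A B : Matrix n} → (∀ i j → B i j ≤ A i j) → LineSums A a → LineSums B b →
             LineSums (λ i j → A i j ∸ B i j) (a ∸ b)
lineSums-∸ {A = A} {B} B≤A (rowsA , colsA) (rowsB , colsB) =
    (λ i → trans (sum-∸ (A i) (B i) (B≤A i)) (cong₂ _∸_ (rowsA i) (rowsB i)))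
  , (λ j → trans (sum-∸ (λ i → A i j) (λ i → B i j) (λ i → B≤A i j)) (cong₂ _∸_ (colsA j) (colsB j)))

support : ∀ {n} → (Fin n → ℕ) → Subset n
support f = tabulate (λ j → does (1 ≤? f j))

∈support⁺ : ∀ {n} (f : Fin n → ℕ) {j} → 0 < f j → j ∈ support f
∈support⁺ f {j} 0<fj = lookup⇒[]= j (support f) (trans (lookup∘tabulate _ j) (dec-true (1 ≤? f j) 0<fj))

∈support⁻ : ∀ {n} (f : Fin n → ℕ) {j} → j ∈ support f → 0 < f j
∈support⁻ f {j} j∈supp = decidable-stable (1 ≤? f j) λ 0≮fj →
  contradiction (trans (sym (dec-false (1 ≤? f j) 0≮fj))
                       (trans (sym (lookup∘tabulate _ j)) ([]=⇒lookup j∈supp))) λ ()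

sumOver-const : ∀ {n} (p : Subset n) (f : Fin n → ℕ) t → (∀ i → f i ≡ t) →
                sumFin (λ i → ⟦ i ∈? p ⟧ * f i) ≡ t * ∣ p ∣
sumOver-const p f t f≡t =
  trans (sum-cong (λ i → trans (cong (⟦ i ∈? p ⟧ *_) (f≡t i)) (*-comm ⟦ i ∈? p ⟧ t)))
        (trans (sum-* t (λ i → ⟦ i ∈? p ⟧)) (cong (t *_) (count p)))
  where
  count : ∀ {n} (p : Subset n) → sumFin (λ i → ⟦ i ∈? p ⟧) ≡ ∣ p ∣
  count []            = refl
  count (inside  ∷ p) = cong suc (count p)
  count (outside ∷ p) = count p

-- Hall's condition for the supports of the rows of a matrix with equal positive
-- line sums t: the t·|S| units in the rows S all lie in the columns N(S).
hallForSupport : ∀ {n} t .{{_ : NonZero t}} (D : Matrix n) → LineSums D t →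
                 Hall.HallCondition (support ∘ D) ⊤ ⊤
hallForSupport {n} t D (rowSums , colSums) S _ =
  subst (∣ S ∣ ≤_) (sym (cong ∣_∣ (∩-identityʳ (N S)))) (*-cancelˡ-≤ t (begin
    t * ∣ S ∣                                            ≡⟨ sumOver-const S (λ i → sumFin (D i)) t rowSums ⟨
    sumFin (λ i → ⟦ i ∈? S ⟧ * sumFin (D i))             ≡⟨ sum-cong (λ i → sum-* ⟦ i ∈? S ⟧ (D i)) ⟨
    sumFin (λ i → sumFin (λ j → ⟦ i ∈? S ⟧ * D i j))     ≤⟨ sum-mono (λ i → sum-mono (massInN i)) ⟩
    sumFin (λ i → sumFin (λ j → ⟦ j ∈? N S ⟧ * D i j))   ≡⟨ sum-swap (λ i j → ⟦ j ∈? N S ⟧ * D i j) ⟩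
    sumFin (λ j → sumFin (λ i → ⟦ j ∈? N S ⟧ * D i j))   ≡⟨ sum-cong (λ j → sum-* ⟦ j ∈? N S ⟧ (λ i → D i j)) ⟩
    sumFin (λ j → ⟦ j ∈? N S ⟧ * sumFin (λ i → D i j))   ≡⟨ sumOver-const (N S) (λ j → sumFin (λ i → D i j)) t colSums ⟩
    t * ∣ N S ∣                                          ∎))
  where
  open Hall (support ∘ D) using (N)
  open ≤-Reasoning
  massInN : ∀ i j → ⟦ i ∈? S ⟧ * D i j ≤ ⟦ j ∈? N S ⟧ * D i j
  massInN i j with i ∈? S | j ∈? N S
  ... | no  _   | _       = z≤n
  ... | yes _   | yes _   = ≤-refl
  ... | yes i∈S | no  j∉N = ≤-trans (≤-reflexive (+-identityʳ (D i j)))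
                                     (≮⇒≥ (λ 0<Dij → j∉N (neighbours⁺ (support ∘ D) i∈S (∈support⁺ (D i) 0<Dij))))

-- A matrix with equal positive line sums has a positive diagonal: an injective
-- choice of a positive entry in every row (König's theorem, via Hall's theorem).
positiveDiagonal : ∀ {n} t .{{_ : NonZero t}} (D : Matrix n) → LineSums D t →
                   Σ (Fin n → Fin n) (λ μ → (∀ i → 0 < D i (μ i)) × Injective _≡_ _≡_ μ)
positiveDiagonal t D sums =
  (λ i → partner M (∈⊤ {x = i})) , (λ i → ∈support⁻ (D i) (adjacent M ∈⊤)) , injective M ∈⊤ ∈⊤
  where
  open Hall (support ∘ D) using (Matching; hall)
  open Matching
  M : Matching ⊤ ⊤
  M = hall ⊤ ⊤ (hallForSupport t D sums)

permutationMatrix : ∀ {n} → (Fin n → Fin n) → Matrix n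
permutationMatrix μ i j = ⟦ μ i ≟ j ⟧

-- Rows of a permutation matrix sum to 1 by construction; its columns sum to
-- at most 1 by injectivity, hence to exactly 1 since the total is n.
permutationMatrix-lineSums : ∀ {n} (μ : Fin n → Fin n) → Injective _≡_ _≡_ μ →
                             LineSums (permutationMatrix μ) 1
permutationMatrix-lineSums {n} μ μ-inj = rowSum , colSum
  where
  rowSum : ∀ i → sumFin (permutationMatrix μ i) ≡ 1
  rowSum i = trans (sum-cong (λ j → sym (*-identityʳ ⟦ μ i ≟ j ⟧))) (sum-δ (μ i) (λ _ → 1))
  total : sumFin (λ j → sumFin (λ i → permutationMatrix μ i j)) ≡ n * 1
  total = trans (sym (sum-swap (permutationMatrix μ))) (trans (sum-cong rowSum) (sum-const n 1))
  colSum : ∀ j → sumFin (λ i → permutationMatrix μ i j) ≡ 1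
  colSum = sum-tight 1 (λ j → sumFin (λ i → permutationMatrix μ i j)) (preimage≤1 μ μ-inj) total

diagonal≤ : ∀ {n} (D : Matrix n) (μ : Fin n → Fin n) → (∀ i → 0 < D i (μ i)) →
            ∀ i j → permutationMatrix μ i j ≤ D i j
diagonal≤ D μ positive i j with μ i ≟ j
... | yes refl = positive i
... | no  _    = z≤n

-- A matrix with line sums k + t dominates a matrix with line sums k: peel off
-- k permutation matrices, each supported on positive entries.
regularSubmatrix : ∀ {n} k t (D : Matrix n) → LineSums D (k + t) →
                   Σ (Matrix n) (λ R → (∀ i j → R i j ≤ D i j) × LineSums R k)
regularSubmatrix {n} zero t D _ =
  (λ _ _ → 0) , (λ _ _ → z≤n) , (λ _ → sum-zero n) , (λ _ → sum-zero n)
regularSubmatrix (suc k) t D sums with positiveDiagonal (suc k + t) D sums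
... | μ , positive , μ-inj
    with regularSubmatrix k t (λ i j → D i j ∸ permutationMatrix μ i j)
                            (lineSums-∸ (diagonal≤ D μ positive) sums (permutationMatrix-lineSums μ μ-inj))
...   | R , R≤D∸P , sumsR =
  (λ i j → permutationMatrix μ i j + R i j) ,
  (λ i j → ≤-trans (+-monoʳ-≤ (permutationMatrix μ i j) (R≤D∸P i j))
                   (≤-reflexive (m+[n∸m]≡n (diagonal≤ D μ positive i j)))) ,
  lineSums-+ (permutationMatrix-lineSums μ μ-inj) sumsR

sumRows : ∀ {n} m k (g : Fin n → ℕ) → m ≤ n →
          (∀ i → toℕ i < m → g i ≡ k) → (∀ i → m ≤ toℕ i → g i ≡ 0) → sumFin g ≡ m * k
sumRows {n} zero k g _ _ empty = trans (sum-cong (λ i → empty i z≤n)) (sum-zero n)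
sumRows {suc n} (suc m) k g (s≤s m≤n) full empty =
  cong₂ _+_ (full zero (s≤s z≤n))
            (sumRows m k (g ∘ suc) m≤n (λ i i<m → full (suc i) (s≤s i<m)) (λ i m≤i → empty (suc i) (s≤s m≤i)))

-- The cell (m, j) may
-- receive symbol s at most capacity j s = k ∸ colCount Q j s times; this
-- capacity matrix has line sums (n ∸ m)·k, so it dominates a matrix with line
-- sums k, which is taken as the new row.
module RowExtension {k m n : ℕ} (Q : Array n) (m<n : m < n) (rect : KLatinRectangle k m n Q) where

  card≤k : ∀ i j → card (Q i j) ≤ k
  card≤k = proj₁ (proj₁ rect)

  rowCount≤k : ∀ i s → rowCount Q i s ≤ k
  rowCount≤k = proj₁ (proj₂ (proj₁ rect))

  colCount≤k : ∀ j s → colCount Q j s ≤ k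
  colCount≤k = proj₂ (proj₂ (proj₁ rect))

  fullCard : ∀ i j → toℕ i < m → card (Q i j) ≡ k
  fullCard = proj₁ (proj₂ rect)

  empty : ∀ i j → m ≤ toℕ i → ∀ s → Q i j s ≡ 0
  empty = proj₂ (proj₂ rect)

  -- Each full row contains each symbol exactly k times: n cells of k symbols
  -- are shared among n symbols, none occurring more than k times.
  fullRowCount : ∀ i → toℕ i < m → ∀ s → rowCount Q i s ≡ k
  fullRowCount i i<m = sum-tight k (rowCount Q i) (rowCount≤k i)
    (trans (sym (sum-swap (Q i))) (trans (sum-cong (λ j → fullCard i j i<m)) (sum-const n k)))

  emptyCard : ∀ i j → m ≤ toℕ i → card (Q i j) ≡ 0
  emptyCard i j m≤i = trans (sum-cong (empty i j m≤i)) (sum-zero n)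

  emptyRowCount : ∀ i → m ≤ toℕ i → ∀ s → rowCount Q i s ≡ 0
  emptyRowCount i m≤i s = trans (sum-cong (λ j → empty i j m≤i s)) (sum-zero n)

  capacity : Matrix n
  capacity j s = k ∸ colCount Q j s

  -- n·k ∸ m·k = (n ∸ m)·k splits off one copy of k because m < n.
  spare : n * k ∸ m * k ≡ k + (n ∸ suc m) * k
  spare = trans (sym (*-distribʳ-∸ k n m)) (cong (_* k) (+-∸-assoc 1 m<n))

  -- Column j of Q holds m·k symbols and symbol s occurs m·k times in Q, so each
  -- row and column of the capacity matrix sums to n·k ∸ m·k.
  capacity-lineSums : LineSums capacity (k + (n ∸ suc m) * k)
  capacity-lineSums = columnSlack , symbolSlack
    where
    columnSlack : ∀ j → sumFin (capacity j) ≡ k + (n ∸ suc m) * k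
    columnSlack j = begin
      sumFin (capacity j)                               ≡⟨ sum-∸ (λ _ → k) (colCount Q j) (colCount≤k j) ⟩
      sumFin {n} (λ _ → k) ∸ sumFin (colCount Q j)      ≡⟨ cong (_∸ sumFin (colCount Q j)) (sum-const n k) ⟩
      n * k ∸ sumFin (λ s → sumFin (λ i → Q i j s))     ≡⟨ cong (n * k ∸_) (sum-swap (λ i s → Q i j s)) ⟨
      n * k ∸ sumFin (λ i → card (Q i j))               ≡⟨ cong (n * k ∸_) (sumRows m k (λ i → card (Q i j)) (<⇒≤ m<n)
                                                                             (λ i i<m → fullCard i j i<m) (λ i m≤i → emptyCard i j m≤i)) ⟩
      n * k ∸ m * k                                     ≡⟨ spare ⟩
      k + (n ∸ suc m) * k                               ∎
      where open ≡-Reasoning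
    symbolSlack : ∀ s → sumFin (λ j → capacity j s) ≡ k + (n ∸ suc m) * k
    symbolSlack s = begin
      sumFin (λ j → capacity j s)                         ≡⟨ sum-∸ (λ _ → k) (λ j → colCount Q j s) (λ j → colCount≤k j s) ⟩
      sumFin {n} (λ _ → k) ∸ sumFin (λ j → colCount Q j s) ≡⟨ cong (_∸ sumFin (λ j → colCount Q j s)) (sum-const n k) ⟩
      n * k ∸ sumFin (λ j → sumFin (λ i → Q i j s))       ≡⟨ cong (n * k ∸_) (sum-swap (λ i j → Q i j s)) ⟨
      n * k ∸ sumFin (λ i → rowCount Q i s)               ≡⟨ cong (n * k ∸_) (sumRows m k (λ i → rowCount Q i s) (<⇒≤ m<n)
                                                                               (λ i i<m → fullRowCount i i<m s) (λ i m≤i → emptyRowCount i m≤i s)) ⟩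
      n * k ∸ m * k                                       ≡⟨ spare ⟩
      k + (n ∸ suc m) * k                                 ∎
      where open ≡-Reasoning

  -- The new row: newRow j s copies of s go to cell (m, j).
  newRow : Matrix n
  newRow = proj₁ (regularSubmatrix k ((n ∸ suc m) * k) capacity capacity-lineSums)

  newRow≤capacity : ∀ j s → newRow j s ≤ capacity j s
  newRow≤capacity = proj₁ (proj₂ (regularSubmatrix k ((n ∸ suc m) * k) capacity capacity-lineSums))

  newRow-lineSums : LineSums newRow k
  newRow-lineSums = proj₂ (proj₂ (regularSubmatrix k ((n ∸ suc m) * k) capacity capacity-lineSums))

  i₀ : Fin n
  i₀ = fromℕ< m<n

  toℕ-i₀ : toℕ i₀ ≡ m
  toℕ-i₀ = toℕ-fromℕ< m<n

  extended : Array n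
  extended i j s = Q i j s + ⟦ i₀ ≟ i ⟧ * newRow j s

  card-extended : ∀ i j → card (extended i j) ≡ card (Q i j) + ⟦ i₀ ≟ i ⟧ * k
  card-extended i j = trans (sum-+ (Q i j) (λ s → ⟦ i₀ ≟ i ⟧ * newRow j s))
    (cong (card (Q i j) +_) (trans (sum-* ⟦ i₀ ≟ i ⟧ (newRow j)) (cong (⟦ i₀ ≟ i ⟧ *_) (proj₁ newRow-lineSums j))))

  rowCount-extended : ∀ i s → rowCount extended i s ≡ rowCount Q i s + ⟦ i₀ ≟ i ⟧ * k
  rowCount-extended i s = trans (sum-+ (λ j → Q i j s) (λ j → ⟦ i₀ ≟ i ⟧ * newRow j s))
    (cong (rowCount Q i s +_) (trans (sum-* ⟦ i₀ ≟ i ⟧ (λ j → newRow j s)) (cong (⟦ i₀ ≟ i ⟧ *_) (proj₂ newRow-lineSums s))))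

  colCount-extended : ∀ j s → colCount extended j s ≡ colCount Q j s + newRow j s
  colCount-extended j s = trans (sum-+ (λ i → Q i j s) (λ i → ⟦ i₀ ≟ i ⟧ * newRow j s))
                                (cong (colCount Q j s +_) (sum-δ i₀ (λ _ → newRow j s)))

  rowOf-i₀ : ∀ {i} → i₀ ≡ i → m ≤ toℕ i
  rowOf-i₀ refl = ≤-reflexive (sym toℕ-i₀)

  -- Every count of the extended array is a count x of Q plus, in row i₀ only,
  -- the corresponding count c of the new row; x vanishes in row i₀ since it is empty.
  offRow-i₀ : ∀ i x c → i₀ ≢ i → x + ⟦ i₀ ≟ i ⟧ * c ≡ x
  offRow-i₀ i x c i₀≢i with i₀ ≟ i
  ... | yes i₀≡i = contradiction i₀≡i i₀≢i
  ... | no  _    = +-identityʳ x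

  boundedAfterAdding : ∀ i x → (i₀ ≡ i → x ≡ 0) → x ≤ k → x + ⟦ i₀ ≟ i ⟧ * k ≤ k
  boundedAfterAdding i x vanishes x≤k with i₀ ≟ i
  ... | yes i₀≡i = ≤-reflexive (trans (cong (_+ (k + 0)) (vanishes i₀≡i)) (+-identityʳ k))
  ... | no  _    = ≤-trans (≤-reflexive (+-identityʳ x)) x≤k

  fullAfterAdding : ∀ i x → toℕ i < suc m → (i₀ ≡ i → x ≡ 0) → (toℕ i < m → x ≡ k) →
                    x + ⟦ i₀ ≟ i ⟧ * k ≡ k
  fullAfterAdding i x i<1+m vanishes full with i₀ ≟ i
  ... | yes i₀≡i = trans (cong (_+ (k + 0)) (vanishes i₀≡i)) (+-identityʳ k)
  ... | no  i₀≢i = trans (+-identityʳ x)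
                         (full (≤∧≢⇒< (s≤s⁻¹ i<1+m) (λ i≡m → i₀≢i (toℕ-injective (trans toℕ-i₀ (sym i≡m))))))

  extended-isRectangle : KLatinRectangle k (suc m) n extended
  extended-isRectangle = (card≤k′ , rowCount≤k′ , colCount≤k′) , fullCard′ , empty′
    where
    card≤k′ : ∀ i j → card (extended i j) ≤ k
    card≤k′ i j = subst (_≤ k) (sym (card-extended i j))
      (boundedAfterAdding i (card (Q i j)) (λ i₀≡i → emptyCard i j (rowOf-i₀ i₀≡i)) (card≤k i j))
    rowCount≤k′ : ∀ i s → rowCount extended i s ≤ k
    rowCount≤k′ i s = subst (_≤ k) (sym (rowCount-extended i s))
      (boundedAfterAdding i (rowCount Q i s) (λ i₀≡i → emptyRowCount i (rowOf-i₀ i₀≡i) s) (rowCount≤k i s))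
    colCount≤k′ : ∀ j s → colCount extended j s ≤ k
    colCount≤k′ j s = begin
      colCount extended j s          ≡⟨ colCount-extended j s ⟩
      colCount Q j s + newRow j s    ≤⟨ +-monoʳ-≤ (colCount Q j s) (newRow≤capacity j s) ⟩
      colCount Q j s + capacity j s  ≡⟨ m+[n∸m]≡n (colCount≤k j s) ⟩
      k                              ∎
      where open ≤-Reasoning
    fullCard′ : ∀ i j → toℕ i < suc m → card (extended i j) ≡ k
    fullCard′ i j i<1+m = trans (card-extended i j)
      (fullAfterAdding i (card (Q i j)) i<1+m (λ i₀≡i → emptyCard i j (rowOf-i₀ i₀≡i)) (fullCard i j))
    empty′ : ∀ i j → suc m ≤ toℕ i → ∀ s → extended i j s ≡ 0
    empty′ i j m<i s = trans (offRow-i₀ i (Q i j s) (newRow j s) (λ i₀≡i → <-irrefl (trans (sym toℕ-i₀) (cong toℕ i₀≡i)) m<i))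
                             (empty i j (<⇒≤ m<i) s)

  extends : ∀ i j → Q i j ⊆ₘ extended i j
  extends i j s = m≤m+n (Q i j s) (⟦ i₀ ≟ i ⟧ * newRow j s)

complete : ∀ {k n} r m (Q : Array n) → r + m ≡ n → KLatinRectangle k m n Q →
           Σ (Array n) (λ L → KLatinSquare k n L × (∀ i j → Q i j ⊆ₘ L i j))
complete zero m Q refl rect = Q , (proj₁ rect , λ i j → proj₁ (proj₂ rect) i j (toℕ<n i)) , λ i j s → ≤-refl
complete {k} {n} (suc r) m Q r+m≡n rect =
  proj₁ rest , proj₁ (proj₂ rest) , λ i j s → ≤-trans (extends i j s) (proj₂ (proj₂ rest) i j s)
  where
  open RowExtension Q (subst (m <_) r+m≡n (s≤s (m≤n+m m r))) rect
    using (extended; extended-isRectangle; extends)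
  rest : Σ (Array n) (λ L → KLatinSquare k n L × (∀ i j → extended i j ⊆ₘ L i j))
  rest = complete r (suc m) extended (trans (+-suc r m) r+m≡n) extended-isRectangle

mainTheorem7 : (k m n : ℕ) → 0 < k → 0 < m → 0 < n → m ≤ n →
    (P : Array n) → KLatinRectangle k m n P →
    Σ (Array n) (λ L → KLatinSquare k n L × (∀ i j → P i j ⊆ₘ L i j))
mainTheorem7 k m n _ _ _ m≤n P rect = complete (n ∸ m) m P (m∸n+n≡m m≤n) rect
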